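{- Let $\mathbf P=(P,\le,{}^*,0,1)$ be a pseudocomplemented poset. Then $\mathbf{Cl}(\mathbf P)=(\mathrm{Cl}(\mathbf P),\vee,\cap,{}^\perp,\{0\},P)$ is a complete ortholattice with $\bigvee_{i\in I}A_i=(\bigcup_{i\in I}A_i)^{\perp\perp}$ and $\bigwedge_{i\in I}A_i=\bigcap_{i\in I}A_i$ for all families $(A_i)_{i\in I}$ of elements of $\mathrm{Cl}(\mathbf P)$.
   Context: A bounded poset $(P,\le,0,1)$ is pseudocomplemented if for each $x\in P$ there exists a greatest element $y\in P$ such that the infimum $x\wedge y$ exists and equals $0$; it is denoted $x^*$. The orthogonality relation is $x\perp y$ iff $y\le x^*$. For $A\subseteq P$, $A^\perp:=\{x\in P\mid x\perp y\text{ for all }y\in A\}$. A subset $A$ is closed if $A^{\perp\perp}=A$; $\mathrm{Cl}(\mathbf P)$ is the set of all closed subsets of $P$. A complete ortholattice is a complete bounded lattice with an antitone involution $'$ satisfying $x\wedge x'=0$ and $x\vee x'=1$. -}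

module Defs where

open import Level using (Level; _⊔_; Lift) renaming (suc to lsuc)
open import Data.Product using (_×_)
open import Data.Unit.Polymorphic using (⊤)
open import Relation.Binary.Bundles using (Poset)
open import Relation.Unary using (Pred; _⊆_; _≐_; _∩_; _∪_; ⋃; ⋂)

-- A bounded pseudocomplemented poset (P, ≤, *, 0, 1).
-- x * is the greatest y such that the infimum x ∧ y exists and equals 0.
-- Since 0 is a lower bound of everything, "inf {x,y} exists and equals 0"
-- means exactly: every common lower bound z of x and y satisfies z ≤ 0.
record PseudocomplementedPoset (ℓ : Level) : Set (lsuc ℓ) where
  field
    poset : Poset ℓ ℓ ℓ
  open Poset poset public
  field
    𝟘 𝟙 : Carrier
    𝟘-least    : ∀ x → 𝟘 ≤ x
    𝟙-greatest : ∀ x → x ≤ 𝟙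
    _*         : Carrier → Carrier
    *-meet-𝟘   : ∀ x z → z ≤ x → z ≤ x * → z ≤ 𝟘
    *-greatest : ∀ x y → (∀ z → z ≤ x → z ≤ y → z ≤ 𝟘) → y ≤ x *

module PCP {ℓ : Level} (𝐏 : PseudocomplementedPoset ℓ) where
  open PseudocomplementedPoset 𝐏

  _⊥_ : Carrier → Carrier → Set ℓ
  x ⊥ y = y ≤ x *

  _^⊥ : Pred Carrier ℓ → Pred Carrier ℓ
  (A ^⊥) x = ∀ y → A y → x ⊥ y

  Closed : Pred Carrier ℓ → Set ℓ
  Closed A = ((A ^⊥) ^⊥) ≐ A

  zeroSet : Pred Carrier ℓ
  zeroSet x = x ≈ 𝟘

  fullSet : Pred Carrier ℓ
  fullSet _ = ⊤

  _∨Cl_ : Pred Carrier ℓ → Pred Carrier ℓ → Pred Carrier ℓ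
  A ∨Cl B = ((A ∪ B) ^⊥) ^⊥

  ⋁Cl : {I : Set ℓ} → (I → Pred Carrier ℓ) → Pred Carrier ℓ
  ⋁Cl {I} F = ((⋃ I F) ^⊥) ^⊥

  ⋀Cl : {I : Set ℓ} → (I → Pred Carrier ℓ) → Pred Carrier ℓ
  ⋀Cl {I} F = ⋂ I F

-- Generic notion: the elements of X satisfying S, ordered by ≤ (equality
-- being mutual ≤), with the given operations, form a complete ortholattice
-- (complete bounded lattice with binary ∨, ∧, arbitrary ⋁, ⋀ over families
-- indexed by types of level i, and an antitone involution ' with
-- a ∧ a' = 0 and a ∨ a' = 1).
record IsCompleteOrtholatticeOn {x s r : Level} (i : Level) {X : Set x}
    (S : X → Set s) (_≤_ : X → X → Set r)
    (_∨_ _∧_ : X → X → X) (_′ : X → X) (𝟎 𝟏 : X)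
    (⋁ ⋀ : {I : Set i} → (I → X) → X) : Set (x ⊔ s ⊔ r ⊔ Level.suc i) where
  _≈_ : X → X → Set r
  a ≈ b = (a ≤ b) × (b ≤ a)
  field
    𝟎∈ : S 𝟎
    𝟏∈ : S 𝟏
    ′∈ : ∀ {a} → S a → S (a ′)
    ∨∈ : ∀ {a b} → S a → S b → S (a ∨ b)
    ∧∈ : ∀ {a b} → S a → S b → S (a ∧ b)
    ⋁∈ : ∀ {I : Set i} (F : I → X) → (∀ j → S (F j)) → S (⋁ F)
    ⋀∈ : ∀ {I : Set i} (F : I → X) → (∀ j → S (F j)) → S (⋀ F)
    ≤-refl  : ∀ {a} → S a → a ≤ a
    ≤-trans : ∀ {a b c} → S a → S b → S c → a ≤ b → b ≤ c → a ≤ c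
    ∨-ub₁ : ∀ {a b} → S a → S b → a ≤ (a ∨ b)
    ∨-ub₂ : ∀ {a b} → S a → S b → b ≤ (a ∨ b)
    ∨-lub : ∀ {a b c} → S a → S b → S c → a ≤ c → b ≤ c → (a ∨ b) ≤ c
    ∧-lb₁ : ∀ {a b} → S a → S b → (a ∧ b) ≤ a
    ∧-lb₂ : ∀ {a b} → S a → S b → (a ∧ b) ≤ b
    ∧-glb : ∀ {a b c} → S a → S b → S c → c ≤ a → c ≤ b → c ≤ (a ∧ b)
    ⋁-ub  : ∀ {I : Set i} (F : I → X) → (∀ j → S (F j)) → ∀ j → F j ≤ ⋁ F
    ⋁-lub : ∀ {I : Set i} (F : I → X) → (∀ j → S (F j)) → ∀ {c} → S c →
            (∀ j → F j ≤ c) → ⋁ F ≤ c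
    ⋀-lb  : ∀ {I : Set i} (F : I → X) → (∀ j → S (F j)) → ∀ j → ⋀ F ≤ F j
    ⋀-glb : ∀ {I : Set i} (F : I → X) → (∀ j → S (F j)) → ∀ {c} → S c →
            (∀ j → c ≤ F j) → c ≤ ⋀ F
    𝟎-least    : ∀ {a} → S a → 𝟎 ≤ a
    𝟏-greatest : ∀ {a} → S a → a ≤ 𝟏
    ′-antitone  : ∀ {a b} → S a → S b → a ≤ b → (b ′) ≤ (a ′)
    ′-involutive : ∀ {a} → S a → ((a ′) ′) ≈ a
    ′-meet      : ∀ {a} → S a → (a ∧ (a ′)) ≈ 𝟎
    ′-join      : ∀ {a} → S a → (a ∨ (a ′)) ≈ 𝟏

-- The relation x ⊥ y is symmetric (y ≤ x* says exactly that the infimum of x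
-- and y is 0), so A ↦ A^⊥ is an antitone Galois connection of the powerset
-- with itself: A ↦ A^⊥⊥ is a closure operator, every A^⊥ is closed, closed
-- sets are stable under arbitrary intersections, and ⊥ is an antitone
-- involution on them.  The ortholattice laws then rest on two facts about 0:
-- it is orthogonal to everything and it is the only element orthogonal to
-- itself.  Hence every closed set contains 0, A ∩ A^⊥ = {0}, and
-- (A ∪ A^⊥)^⊥ = A^⊥ ∩ A^⊥⊥ = {0}, whose orthogonal is all of P.
module Submission where

open import Defs
open import Level using (Level; _⊔_)
open import Data.Product using (_,_; proj₁; proj₂)
open import Data.Sum using (inj₁; inj₂; [_,_])
open import Data.Unit.Polymorphic using (tt)
open import Relation.Binary.Definitions using (Symmetric)
open import Relation.Unary using (Pred; _⊆_; _∩_; _∪_; ⋂)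

module Polarity {a ℓ : Level} {X : Set a}
    (_⊥_ : X → X → Set ℓ) (⊥-sym : Symmetric _⊥_) where

  _^⊥ : Pred X (a ⊔ ℓ) → Pred X (a ⊔ ℓ)
  (A ^⊥) x = ∀ y → A y → x ⊥ y

  ^⊥-antitone : {A B : Pred X (a ⊔ ℓ)} → A ⊆ B → B ^⊥ ⊆ A ^⊥
  ^⊥-antitone A⊆B x⊥B y Ay = x⊥B y (A⊆B Ay)

  ⊆-^⊥^⊥ : {A : Pred X (a ⊔ ℓ)} → A ⊆ (A ^⊥) ^⊥
  ⊆-^⊥^⊥ Ax y y⊥A = ⊥-sym (y⊥A _ Ax)

  ^⊥^⊥^⊥⊆^⊥ : {A : Pred X (a ⊔ ℓ)} → ((A ^⊥) ^⊥) ^⊥ ⊆ A ^⊥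
  ^⊥^⊥^⊥⊆^⊥ = ^⊥-antitone ⊆-^⊥^⊥

  ^⊥^⊥-least : {A B : Pred X (a ⊔ ℓ)} → (B ^⊥) ^⊥ ⊆ B → A ⊆ B → (A ^⊥) ^⊥ ⊆ B
  ^⊥^⊥-least B-closed A⊆B x = B-closed (^⊥-antitone (^⊥-antitone A⊆B) x)

  ^⊥-∪ : {A B : Pred X (a ⊔ ℓ)} → (A ∪ B) ^⊥ ⊆ A ^⊥ ∩ B ^⊥
  ^⊥-∪ x⊥A∪B = (λ y Ay → x⊥A∪B y (inj₁ Ay)) , (λ y By → x⊥A∪B y (inj₂ By))

module ClosedSets {ℓ : Level} (𝐏 : PseudocomplementedPoset ℓ) where
  open PseudocomplementedPoset 𝐏
  open PCP 𝐏

  ⊥-sym : Symmetric _⊥_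
  ⊥-sym {x} {y} y≤x* = *-greatest y x (λ z z≤y z≤x → *-meet-𝟘 x z z≤x (trans z≤y y≤x*))

  ⊥-self⇒≈𝟘 : ∀ {x} → x ⊥ x → x ≈ 𝟘
  ⊥-self⇒≈𝟘 {x} x≤x* = antisym (*-meet-𝟘 x x refl x≤x*) (𝟘-least x)

  ≈𝟘⇒⊥ : ∀ {x y} → x ≈ 𝟘 → x ⊥ y
  ≈𝟘⇒⊥ {x} {y} x≈𝟘 = *-greatest x y (λ z z≤x _ → trans z≤x (reflexive x≈𝟘))

  -- Polarity's _^⊥ unfolds to the one of PCP, so its lemmas apply to it.
  open Polarity _⊥_ ⊥-sym public hiding (_^⊥)

  fullSet⊆zeroSet^⊥ : fullSet ⊆ zeroSet ^⊥
  fullSet⊆zeroSet^⊥ _ y y≈𝟘 = ⊥-sym (≈𝟘⇒⊥ y≈𝟘)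

  fullSet^⊥⊆zeroSet : fullSet ^⊥ ⊆ zeroSet
  fullSet^⊥⊆zeroSet {x} x⊥P = ⊥-self⇒≈𝟘 (x⊥P x tt)

  zeroSet⊆Closed : {A : Pred Carrier ℓ} → Closed A → zeroSet ⊆ A
  zeroSet⊆Closed (A^⊥⊥⊆A , _) x≈𝟘 = A^⊥⊥⊆A (λ _ _ → ≈𝟘⇒⊥ x≈𝟘)

  ∩-^⊥⊆zeroSet : {A : Pred Carrier ℓ} → A ∩ A ^⊥ ⊆ zeroSet
  ∩-^⊥⊆zeroSet (Ax , x⊥A) = ⊥-self⇒≈𝟘 (x⊥A _ Ax)

  ^⊥-Closed : {A : Pred Carrier ℓ} → Closed (A ^⊥)
  ^⊥-Closed = ^⊥^⊥^⊥⊆^⊥ , ⊆-^⊥^⊥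

  ∩-Closed : {A B : Pred Carrier ℓ} → Closed A → Closed B → Closed (A ∩ B)
  ∩-Closed (A-closed , _) (B-closed , _) =
    (λ x → ^⊥^⊥-least A-closed proj₁ x , ^⊥^⊥-least B-closed proj₂ x) , ⊆-^⊥^⊥

  ⋂-Closed : {I : Set ℓ} (F : I → Pred Carrier ℓ) →
             (∀ j → Closed (F j)) → Closed (⋂ I F)
  ⋂-Closed F F-closed = (λ x j → ^⊥^⊥-least (proj₁ (F-closed j)) (λ h → h j) x) , ⊆-^⊥^⊥

  zeroSet-Closed : Closed zeroSet
  zeroSet-Closed = (λ x → fullSet^⊥⊆zeroSet (^⊥-antitone fullSet⊆zeroSet^⊥ x)) , ⊆-^⊥^⊥

  fullSet⊆[∪^⊥]^⊥^⊥ : {A : Pred Carrier ℓ} → fullSet ⊆ (A ∪ A ^⊥) ^⊥ ^⊥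
  fullSet⊆[∪^⊥]^⊥^⊥ x = ^⊥-antitone (λ y → ∩-^⊥⊆zeroSet (^⊥-∪ y)) (fullSet⊆zeroSet^⊥ x)

theorem5 : {ℓ : Level} (𝐏 : PseudocomplementedPoset ℓ) →
    let open PCP 𝐏 in
    IsCompleteOrtholatticeOn ℓ Closed _⊆_ _∨Cl_ _∩_ _^⊥ zeroSet fullSet ⋁Cl ⋀Cl
theorem5 𝐏 = record
  { 𝟎∈ = zeroSet-Closed
  ; 𝟏∈ = (λ _ → tt) , ⊆-^⊥^⊥
  ; ′∈ = λ _ → ^⊥-Closed
  ; ∨∈ = λ _ _ → ^⊥-Closed
  ; ∧∈ = ∩-Closed
  ; ⋁∈ = λ _ _ → ^⊥-Closed
  ; ⋀∈ = ⋂-Closed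
  ; ≤-refl = λ _ x → x
  ; ≤-trans = λ _ _ _ A⊆B B⊆C x → B⊆C (A⊆B x)
  ; ∨-ub₁ = λ _ _ x → ⊆-^⊥^⊥ (inj₁ x)
  ; ∨-ub₂ = λ _ _ x → ⊆-^⊥^⊥ (inj₂ x)
  ; ∨-lub = λ _ _ (C-closed , _) A⊆C B⊆C → ^⊥^⊥-least C-closed [ A⊆C , B⊆C ]
  ; ∧-lb₁ = λ _ _ → proj₁
  ; ∧-lb₂ = λ _ _ → proj₂
  ; ∧-glb = λ _ _ _ C⊆A C⊆B x → C⊆A x , C⊆B x
  ; ⋁-ub = λ _ _ j x → ⊆-^⊥^⊥ (j , x)
  ; ⋁-lub = λ _ _ (C-closed , _) F⊆C → ^⊥^⊥-least C-closed (λ (j , x) → F⊆C j x)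
  ; ⋀-lb = λ _ _ j x → x j
  ; ⋀-glb = λ _ _ _ C⊆F x j → C⊆F j x
  ; 𝟎-least = zeroSet⊆Closed
  ; 𝟏-greatest = λ _ _ → tt
  ; ′-antitone = λ _ _ → ^⊥-antitone
  ; ′-involutive = λ A-closed → A-closed
  ; ′-meet = λ A-closed → ∩-^⊥⊆zeroSet
                       , λ x≈𝟘 → zeroSet⊆Closed A-closed x≈𝟘 , zeroSet⊆Closed ^⊥-Closed x≈𝟘
  ; ′-join = λ _ → (λ _ → tt) , fullSet⊆[∪^⊥]^⊥^⊥
  }
  where open ClosedSets 𝐏
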